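{- Let $S\subseteq\{0,1\}^*$ be a prefix-free set, $T$ a z-fast trie on $S$, $x$ a nonempty binary string, $a$ an integer with $0\le a<|x|$ such that $a=0$ or $x[0\..a)$ is an internal extent of the compacted trie on $S$, and $b\le|x|$ an integer larger than the length of the longest internal extent that is a proper prefix of $x$. Let $p_0=\epsilon$ and let $p_1,\dots,p_t$ be the internal extents of the compacted trie on $S$ that are proper prefixes of $x$, ordered by increasing length. Let $(a\..b)$ denote the interval maintained by the fat binary search algorithm run on $x,a,b$. Then before and after each iteration of its loop: (1) $a=|p_j|$ for some $j\in\{0,\dots,t\}$; (2) $|p_t|<b$. Consequently, at the end of the loop $a=|p_t|$.
   Context: For a string $x$, $x[i\..j)$ denotes the substring of $x$ from position $i$ (inclusive) to position $j$ (exclusive), positions starting at $0$; $\preceq$ is the prefix order and $\prec$ its strict version; $\epsilon$ is the empty string. Consider the compacted trie of a prefix-free set $S\subseteq\{0,1\}^*$. For a node $\alpha$: its extent $e_\alpha$ is the longest common prefix of the strings of $S$ represented by the leaves below $\alpha$ (extents of internal nodes are called internal extents); its compacted path $c_\alpha$ is the string labelling $\alpha$; its name $n_\alpha$ is $e_\alpha$ with the suffix $c_\alpha$ removed; its skip interval is $[1\..|e_\alpha|]$ for the root and $[|n_\alpha|\..|e_\alpha|]$ otherwise. The 2-fattest number of an interval of positive integers is the unique integer in it divisible by the largest power of two. The handle $h_\alpha$ of $\alpha$ is the prefix of $e_\alpha$ whose length is the 2-fattest number in the skip interval of $\alpha$ (the empty string if the skip interval is empty). A z-fast trie on $S$ is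 a function $T$ from binary strings to internal extents such that $T(h_\alpha)=e_\alpha$ for every internal node $\alpha$, and $T$ maps every other string to an arbitrary internal extent. The fat binary search algorithm on inputs $x,a,b$: while $b-a>1$, let $f$ be the 2-fattest number in the open interval $(a\..b)$ and $e=T(x[0\..f))$; if $f\le|e|$ and $e\prec x$, set $a\leftarrow|e|$, otherwise set $b\leftarrow f$. After the loop, if $a=0$ and $e_{\mathrm{root}}\ne\epsilon$ return $\epsilon$, otherwise return $x[0\..a+1)$. -}

module Defs where

open import Data.Bool using (Bool; true; false)
open import Data.List using (List; []; _∷_; _++_; length; take)
open import Data.List.Membership.Propositional using (_∈_)
open import Data.Nat using (ℕ; zero; suc; pred; _≤_; _<_; _^_)
open import Data.Nat.Divisibility using (_∣_)
open import Data.Product using (Σ; ∃; ∃-syntax; _×_; _,_)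
open import Data.Sum using (_⊎_)
open import Relation.Nullary using (¬_)
open import Relation.Binary.PropositionalEquality using (_≡_; _≢_)
open import Relation.Binary.Construct.Closure.ReflexiveTransitive using (Star)

Str : Set
Str = List Bool

_⪯_ : Str → Str → Set
u ⪯ v = ∃[ w ] (u ++ w ≡ v)

_≺_ : Str → Str → Set
u ≺ v = u ⪯ v × u ≢ v

PrefixFree : List Str → Set
PrefixFree S = ∀ u v → u ∈ S → v ∈ S → u ⪯ v → u ≡ v

-- e is the extent of an internal node of the compacted trie on S:
-- e is a branching point, i.e. both e0 and e1 are prefixes of strings of S.
InternalExtent : List Str → Str → Set
InternalExtent S e =
  (∃[ u ] (u ∈ S × (e ++ (false ∷ [])) ⪯ u)) ×
  (∃[ u ] (u ∈ S × (e ++ (true ∷ [])) ⪯ u))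

Fattest : ℕ → ℕ → ℕ → Set
Fattest l r f =
  l ≤ f × f ≤ r ×
  ∃[ k ] ((2 ^ k) ∣ f × (∀ g → l ≤ g → g ≤ r → ¬ ((2 ^ suc k) ∣ g)))

-- l is the left end of the skip interval of the internal node with extent e:
-- 1 for the root (no internal extent is a proper prefix of e), and otherwise
-- |n_α| = |e_parent| + 1, the parent being the longest internal extent that
-- is a proper prefix of e.
SkipLow : List Str → Str → ℕ → Set
SkipLow S e l =
  ((∀ p → InternalExtent S p → ¬ (p ≺ e)) × l ≡ 1)
  ⊎ (∃[ p ] (InternalExtent S p × p ≺ e ×
             (∀ q → InternalExtent S q → q ≺ e → length q ≤ length p) ×
             l ≡ suc (length p)))

Handle : List Str → Str → Str → Set
Handle S e h =
  ∃[ l ] (SkipLow S e l ×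
    ((l ≤ length e × h ⪯ e × Fattest l (length e) (length h))
     ⊎ (length e < l × h ≡ [])))

ZFastTrie : List Str → (Str → Str) → Set
ZFastTrie S T =
  (∀ y → InternalExtent S (T y)) ×
  (∀ e h → InternalExtent S e → Handle S e h → T h ≡ e)

data Step (x : Str) (T : Str → Str) : ℕ × ℕ → ℕ × ℕ → Set where
  step-yes : ∀ {a b} f → suc (suc a) ≤ b → Fattest (suc a) (pred b) f →
             f ≤ length (T (take f x)) → T (take f x) ≺ x →
             Step x T (a , b) (length (T (take f x)) , b)
  step-no  : ∀ {a b} f → suc (suc a) ≤ b → Fattest (suc a) (pred b) f →
             ¬ (f ≤ length (T (take f x)) × T (take f x) ≺ x) →
             Step x T (a , b) (a , f)

Reachable : Str → (Str → Str) → ℕ × ℕ → ℕ × ℕ → Set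
Reachable x T = Star (Step x T)

IsP : List Str → Str → Str → Set
IsP S x p = p ≡ [] ⊎ (InternalExtent S p × p ≺ x)

IsPt : List Str → Str → Str → Set
IsPt S x p = IsP S x p × (∀ q → IsP S x q → length q ≤ length p)

-- Both invariants are immediate except (2) after a failed probe at f.  If
-- some p_j had |p_j| ≥ f, take the shortest such one, e.  Its parent is
-- shorter than f and at least as long as a (a being the length of some p_i,
-- which is then a proper prefix of e), and |e| < b, so the skip interval of e
-- contains f and lies inside (a .. b).  The 2-fattest number of an interval is
-- also the 2-fattest number of every subinterval containing it, hence x[0 .. f)
-- is the handle of e and T(x[0 .. f)) = e, so the probe would have succeeded.
module Submission where

open import Defs
open import Data.Bool using (true; false)
import Data.Bool.Properties as Bool
open import Data.List using (List; []; _∷_; _++_; length; take; drop)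
open import Data.List.Properties
  using (length-++; length-take; take-take; take++drop≡id; ++-identityʳ)
open import Data.List.Membership.Propositional using (_∈_; find; lose)
open import Data.List.Relation.Unary.Any using (any?)
open import Data.List.Relation.Binary.Prefix.Heterogeneous using (Prefix; []; _∷_)
import Data.List.Relation.Binary.Prefix.Heterogeneous.Properties as Prefix
open import Data.Nat using (ℕ; zero; suc; pred; _≤_; _<_; _⊓_; z≤n; s≤s; _≤?_)
open import Data.Nat.Induction using (<-wellFounded)
open import Data.Nat.Properties
  using (≤-refl; ≤-trans; <-≤-trans; <⇒≤; ≤-pred; <⇒≤pred; <-irrefl;
         ≰⇒>; m<m+n; m≤n⇒m⊓n≡m; ≤∧≢⇒<; m<n⇒m<1+n)
open import Data.Product using (∃; ∃-syntax; _×_; _,_; proj₁; proj₂)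
open import Data.Empty using (⊥)
open import Data.Sum using (_⊎_; inj₁; inj₂)
open import Function using (_∘_; id)
open import Induction.WellFounded using (Acc; acc)
open import Relation.Nullary using (¬_; Dec; yes; no; contradiction)
open import Relation.Nullary.Decidable using (map′; _×-dec_)
open import Relation.Unary using (Decidable)
open import Relation.Binary.PropositionalEquality
  using (_≡_; _≢_; refl; sym; trans; cong; subst; module ≡-Reasoning)
open import Relation.Binary.Construct.Closure.ReflexiveTransitive using (fold)

⪯⇒Prefix : ∀ {u v : Str} → u ⪯ v → Prefix _≡_ u v
⪯⇒Prefix {[]}    _          = []
⪯⇒Prefix {c ∷ u} (w , refl) = refl ∷ ⪯⇒Prefix (w , refl)

Prefix⇒⪯ : ∀ {u v : Str} → Prefix _≡_ u v → u ⪯ v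
Prefix⇒⪯ {v = v} [] = v , refl
Prefix⇒⪯ (refl ∷ p) with w , eq ← Prefix⇒⪯ p = w , cong (_ ∷_) eq

module _ {u v : Str} where

  ⪯⇒length-≤ : u ⪯ v → length u ≤ length v
  ⪯⇒length-≤ = Prefix.length-mono ∘ ⪯⇒Prefix

  ≺⇒length-< : u ≺ v → length u < length v
  ≺⇒length-< (([] , refl) , u≢v) = contradiction (++-identityʳ u) (u≢v ∘ sym)
  ≺⇒length-< ((c ∷ w , refl) , _) =
    subst (length u <_) (sym (length-++ u)) (m<m+n (length u) (s≤s z≤n))

_⪯?_ : (u v : Str) → Dec (u ⪯ v)
u ⪯? v = map′ Prefix⇒⪯ ⪯⇒Prefix (Prefix.prefix? Bool._≟_ u v)

⪯-trans : ∀ {u v w : Str} → u ⪯ v → v ⪯ w → u ⪯ w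
⪯-trans u⪯v v⪯w = Prefix⇒⪯ (Prefix.trans trans (⪯⇒Prefix u⪯v) (⪯⇒Prefix v⪯w))

≺-⪯-trans : ∀ {u v w : Str} → u ≺ v → v ⪯ w → u ≺ w
≺-⪯-trans (u⪯v , u≢v) v⪯w =
  ⪯-trans u⪯v v⪯w ,
  λ { refl → <-irrefl refl (<-≤-trans (≺⇒length-< (u⪯v , u≢v)) (⪯⇒length-≤ v⪯w)) }

length-take-≤ : ∀ {k} (u : Str) → k ≤ length u → length (take k u) ≡ k
length-take-≤ {k} u k≤u = trans (length-take k u) (m≤n⇒m⊓n≡m k≤u)

take-⪯ : ∀ k (u : Str) → take k u ⪯ u
take-⪯ k u = drop k u , take++drop≡id k u

take-≺ : ∀ {k} (u : Str) → k < length u → take k u ≺ u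
take-≺ {k} u k<u =
  take-⪯ k u ,
  λ eq → <-irrefl (trans (sym (length-take-≤ u (<⇒≤ k<u))) (cong length eq)) k<u

take-length-⪯ : ∀ {u v : Str} → u ⪯ v → take (length u) v ≡ u
take-length-⪯ {[]}    _        = refl
take-length-⪯ {c ∷ u} (w , refl) = cong (c ∷_) (take-length-⪯ (w , refl))

take-of-⪯ : ∀ {k} {u v : Str} → u ⪯ v → k ≤ length u → take k v ≡ take k u
take-of-⪯ {k} {u} {v} u⪯v k≤u = begin
  take k v                       ≡⟨ cong (λ i → take i v) (sym (m≤n⇒m⊓n≡m k≤u)) ⟩
  take (k ⊓ length u) v          ≡⟨ sym (take-take k (length u) v) ⟩
  take k (take (length u) v)     ≡⟨ cong (take k) (take-length-⪯ u⪯v) ⟩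
  take k u                       ∎
  where open ≡-Reasoning

module _ {u v x : Str} (u⪯x : u ⪯ x) (v⪯x : v ⪯ x) where

  ⪯-of-shorter : length u ≤ length v → u ⪯ v
  ⪯-of-shorter u≤v =
    subst (_⪯ v) (trans (sym (take-of-⪯ v⪯x u≤v)) (take-length-⪯ u⪯x)) (take-⪯ (length u) v)

  ≺-of-shorter : length u < length v → u ≺ v
  ≺-of-shorter u<v = ⪯-of-shorter (<⇒≤ u<v) , λ { refl → <-irrefl refl u<v }

greatest-below? : {P : ℕ → Set} → Decidable P → ∀ n →
  (∀ k → k < n → ¬ P k) ⊎ ∃[ k ] (k < n × P k × (∀ j → j < n → P j → j ≤ k))
greatest-below? P? zero = inj₁ λ _ ()
greatest-below? P? (suc n) with P? n
... | yes Pn = inj₂ (n , ≤-refl , Pn , λ _ j<1+n _ → ≤-pred j<1+n)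
... | no ¬Pn with greatest-below? P? n
...   | inj₁ none = inj₁ λ k k<1+n Pk → none k (≤∧≢⇒< (≤-pred k<1+n) λ { refl → ¬Pn Pk }) Pk
...   | inj₂ (k , k<n , Pk , max) =
  inj₂ (k , m<n⇒m<1+n k<n , Pk , λ j j<1+n Pj → max j (≤∧≢⇒< (≤-pred j<1+n) λ { refl → ¬Pn Pj }) Pj)

internalExtent? : ∀ S e → Dec (InternalExtent S e)
internalExtent? S e = extended? (e ++ false ∷ []) ×-dec extended? (e ++ true ∷ [])
  where
  extended? : ∀ v → Dec (∃[ u ] (u ∈ S × v ⪯ u))
  extended? v = map′ find (λ (_ , u∈S , v⪯u) → lose u∈S v⪯u) (any? (v ⪯?_) S)

Root : List Str → Str → Set
Root S e = ∀ p → InternalExtent S p → ¬ (p ≺ e)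

Parent : List Str → Str → Str → Set
Parent S e p =
  InternalExtent S p × p ≺ e × (∀ q → InternalExtent S q → q ≺ e → length q ≤ length p)

root-or-parent : ∀ S e → Root S e ⊎ ∃ (Parent S e)
root-or-parent S e = classify (greatest-below? (internalExtent? S ∘ prefix) (length e))
  where
  prefix : ℕ → Str
  prefix k = take k e

  as-prefix : ∀ {p} → p ≺ e → InternalExtent S p → InternalExtent S (prefix (length p))
  as-prefix p≺e = subst (InternalExtent S) (sym (take-length-⪯ (proj₁ p≺e)))

  classify : (∀ k → k < length e → ¬ InternalExtent S (prefix k))
           ⊎ ∃[ k ] (k < length e × InternalExtent S (prefix k) ×
                     (∀ j → j < length e → InternalExtent S (prefix j) → j ≤ k))
           → Root S e ⊎ ∃ (Parent S e)
  classify (inj₁ none) = inj₁ λ p ie p≺e → none (length p) (≺⇒length-< p≺e) (as-prefix p≺e ie)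
  classify (inj₂ (k , k<e , ie , max)) =
    inj₂ (prefix k , ie , take-≺ e k<e , λ q ie′ q≺e →
      subst (length q ≤_) (sym (length-take-≤ e (<⇒≤ k<e)))
            (max (length q) (≺⇒length-< q≺e) (as-prefix q≺e ie′)))

skipLow-root : ∀ {S e} → Root S e → SkipLow S e 1
skipLow-root root = inj₁ (root , refl)

skipLow-parent : ∀ {S e p} → Parent S e p → SkipLow S e (suc (length p))
skipLow-parent {p = p} (ie , p≺e , max) = inj₂ (p , ie , p≺e , max , refl)

IsP-<-skipLow : ∀ {S e l p} → SkipLow S e l → IsP S e p → length p < l
IsP-<-skipLow (inj₁ (_ , refl))            (inj₁ refl)        = s≤s z≤n
IsP-<-skipLow (inj₁ (root , _))            (inj₂ (ie , p≺e)) = contradiction p≺e (root _ ie)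
IsP-<-skipLow (inj₂ (_ , _ , _ , _ , refl)) (inj₁ refl)        = s≤s z≤n
IsP-<-skipLow (inj₂ (_ , _ , _ , max , refl)) (inj₂ (ie , p≺e)) = s≤s (max _ ie p≺e)

IsP-of-shorter : ∀ {S x e p} → IsP S x p → e ⪯ x → length p < length e → IsP S e p
IsP-of-shorter (inj₁ refl)       _   _   = inj₁ refl
IsP-of-shorter (inj₂ (ie , p≺x)) e⪯x p<e = inj₂ (ie , ≺-of-shorter (proj₁ p≺x) e⪯x p<e)

Fattest-restrict : ∀ {l r l′ r′ f} → l ≤ l′ → r′ ≤ r → l′ ≤ f → f ≤ r′ →
                   Fattest l r f → Fattest l′ r′ f
Fattest-restrict l≤l′ r′≤r l′≤f f≤r′ (_ , _ , k , 2ᵏ∣f , maximal) =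
  l′≤f , f≤r′ , k , 2ᵏ∣f , λ g l′≤g g≤r′ → maximal g (≤-trans l≤l′ l′≤g) (≤-trans g≤r′ r′≤r)

take-Handle : ∀ {S e l f} → SkipLow S e l → Fattest l (length e) f → Handle S e (take f e)
take-Handle {e = e} {l} sl fat@(l≤f , f≤e , _) =
  l , sl , inj₁ (≤-trans l≤f f≤e , take-⪯ _ e ,
                 subst (Fattest l (length e)) (sym (length-take-≤ e f≤e)) fat)

module _ {S : List Str} {T : Str → Str} (Z : ZFastTrie S T) {x : Str} {a b f : ℕ}
  (a-is-P : ∃[ p ] (IsP S x p × a ≡ length p)) (IsP-below-b : ∀ p → IsP S x p → length p < b)
  (fat : Fattest (suc a) (pred b) f) (miss : ¬ (f ≤ length (T (take f x)) × T (take f x) ≺ x))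
  where

  0<f : 0 < f
  0<f = ≤-trans (s≤s z≤n) (proj₁ fat)

  failed-probe-outside-skip-interval : ∀ {e l} → InternalExtent S e → e ≺ x → SkipLow S e l →
                                       l ≤ f → f ≤ length e → ⊥
  failed-probe-outside-skip-interval {e} {l} ie e≺x sl l≤f f≤e =
    miss (subst (λ t → f ≤ length t × t ≺ x) (sym T-probe≡e) (f≤e , e≺x))
    where
    a<l : a < l
    a<l = let p , P-p , a≡|p| = a-is-P in
      subst (_< l) (sym a≡|p|) (IsP-<-skipLow sl (IsP-of-shorter P-p (proj₁ e≺x)
        (subst (_< length e) a≡|p| (<-≤-trans (proj₁ fat) f≤e))))

    T-probe≡e : T (take f x) ≡ e
    T-probe≡e = trans (cong T (take-of-⪯ (proj₁ e≺x) f≤e))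
      (proj₂ Z e _ ie (take-Handle sl
        (Fattest-restrict a<l (<⇒≤pred (IsP-below-b e (inj₂ (ie , e≺x)))) l≤f f≤e fat)))

  IsP-below-failed-probe : ∀ p → IsP S x p → length p < f
  IsP-below-failed-probe _ (inj₁ refl)        = 0<f
  IsP-below-failed-probe p (inj₂ (ie , p≺x)) = ≰⇒> (not-above p (<-wellFounded (length p)) ie p≺x)
    where
    not-above : ∀ e → Acc _<_ (length e) → InternalExtent S e → e ≺ x → ¬ f ≤ length e
    not-above e (acc rec) ie e≺x f≤e with root-or-parent S e
    ... | inj₁ root =
      failed-probe-outside-skip-interval ie e≺x (skipLow-root root) 0<f f≤e
    ... | inj₂ (q , parent@(ie-q , q≺e , _)) with f ≤? length q
    ...   | yes f≤q = not-above q (rec (≺⇒length-< q≺e)) ie-q (≺-⪯-trans q≺e (proj₁ e≺x)) f≤q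
    ...   | no  f≰q = failed-probe-outside-skip-interval ie e≺x (skipLow-parent parent) (≰⇒> f≰q) f≤e

Invariant : List Str → Str → ℕ × ℕ → Set
Invariant S x (a , b) = (∃[ p ] (IsP S x p × a ≡ length p)) × (∀ p → IsP S x p → length p < b)

Step-preserves-Invariant : ∀ {S T} → ZFastTrie S T → ∀ {x s s′} →
                           Step x T s s′ → Invariant S x s → Invariant S x s′
Step-preserves-Invariant (extent , _) (step-yes f _ _ _ probe≺x) (_ , IsP-below-b) =
  (_ , inj₂ (extent _ , probe≺x) , refl) , IsP-below-b
Step-preserves-Invariant Z (step-no f _ fat miss) (a-is-P , IsP-below-b) =
  a-is-P , IsP-below-failed-probe Z a-is-P IsP-below-b fat miss

Reachable-preserves-Invariant : ∀ {S T} → ZFastTrie S T → ∀ {x s s′} →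
                                Reachable x T s s′ → Invariant S x s → Invariant S x s′
Reachable-preserves-Invariant {S} Z {x} =
  fold (λ s s′ → Invariant S x s → Invariant S x s′) (λ st k → k ∘ Step-preserves-Invariant Z st) id

IsP-initial : ∀ {S x a} → a < length x → (a ≡ 0 ⊎ InternalExtent S (take a x)) →
              ∃[ p ] (IsP S x p × a ≡ length p)
IsP-initial a<x (inj₁ a≡0) = [] , inj₁ refl , a≡0
IsP-initial {x = x} {a} a<x (inj₂ ie) =
  take a x , inj₂ (ie , take-≺ x a<x) , sym (length-take-≤ x (<⇒≤ a<x))

IsPt-of-Invariant : ∀ {S x a b} → Invariant S x (a , b) → b ≤ suc a →
                    ∃[ p ] (IsPt S x p × a ≡ length p)
IsPt-of-Invariant ((p , P-p , a≡|p|) , IsP-below-b) b≤1+a =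
  p , (P-p , λ q P-q → subst (length q ≤_) a≡|p| (≤-pred (≤-trans (IsP-below-b q P-q) b≤1+a))) , a≡|p|

lemma1 : (S : List Str) → PrefixFree S →
    (T : Str → Str) → ZFastTrie S T →
    (x : Str) → x ≢ [] →
    (a b : ℕ) → a < length x → (a ≡ 0 ⊎ InternalExtent S (take a x)) →
    b ≤ length x → (∀ p → IsP S x p → length p < b) →
    ∀ a' b' → Reachable x T (a , b) (a' , b') →
    ((∃[ p ] (IsP S x p × a' ≡ length p)) × (∀ p → IsP S x p → length p < b'))
    × (b' ≤ suc a' → ∃[ p ] (IsPt S x p × a' ≡ length p))
lemma1 S _ T Z x _ a b a<x a-init _ IsP-below-b a' b' reach = invariant , IsPt-of-Invariant invariant
  where
  invariant : Invariant S x (a' , b')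
  invariant = Reachable-preserves-Invariant Z reach (IsP-initial a<x a-init , IsP-below-b)
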